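{- Let $D_1$ and $D_2$ be acyclic digraphs with $V(D_1)\cap V(D_2)=\emptyset$. Suppose that $C(D_1)$ has $p$ isolated vertices and $D_2$ has $p$ vertices which have no in-neighbors in $D_2$. Let $I_p$ be a set of $p$ isolated vertices of $C(D_1)$. Then there exists an acyclic digraph $D$ such that $C(D)=C(D_1)\cup C(D_2)-I_p$, i.e. $C(D)$ is the graph obtained from the disjoint union of $C(D_1)$ and $C(D_2)$ by deleting the vertices of $I_p$.
   Context: For a digraph $D=(V,A)$, the competition graph $C(D)$ is the (simple) graph with vertex set $V$ in which distinct vertices $x,y$ are adjacent if and only if there is a vertex $v\in V$ such that both arcs $(x,v)$ and $(y,v)$ are in $A$. -}

module Defs where

open import Data.Nat using (ℕ)
open import Data.Fin using (Fin)
open import Data.Fin.Subset using (Subset; _∈_; ∁; ∣_∣) public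
open import Data.Bool using (Bool; T)
open import Data.Empty using (⊥)
open import Data.Sum using (_⊎_; inj₁; inj₂)
open import Data.Product using (Σ; ∃; _×_; _,_)
open import Relation.Nullary using (¬_)
open import Relation.Binary.PropositionalEquality using (_≡_; _≢_)
open import Relation.Binary.Construct.Closure.Transitive using (TransClosure)

Digraph : Set → Set
Digraph V = V → V → Bool

Arc : ∀ {V} → Digraph V → V → V → Set
Arc D x y = T (D x y)

Acyclic : ∀ {V} → Digraph V → Set
Acyclic {V} D = ∀ (v : V) → ¬ TransClosure (Arc D) v v

CompAdj : ∀ {V} → Digraph V → V → V → Set
CompAdj {V} D x y = x ≢ y × ∃ λ (v : V) → Arc D x v × Arc D y v

IsolatedInC : ∀ {V} → Digraph V → V → Set
IsolatedInC D x = ∀ y → ¬ CompAdj D x y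

NoInNeighbor : ∀ {V} → Digraph V → V → Set
NoInNeighbor D v = ∀ u → ¬ Arc D u v

RemVert : ∀ {n₁} (I : Subset n₁) (n₂ : ℕ) → Set
RemVert {n₁} I n₂ = Σ (Fin n₁) (λ u → u ∈ ∁ I) ⊎ Fin n₂

UnionMinusAdj : ∀ {n₁ n₂} → Digraph (Fin n₁) → Digraph (Fin n₂) → (I : Subset n₁) →
                RemVert I n₂ → RemVert I n₂ → Set
UnionMinusAdj D₁ D₂ I (inj₁ (u , _)) (inj₁ (w , _)) = CompAdj D₁ u w
UnionMinusAdj D₁ D₂ I (inj₂ u) (inj₂ w) = CompAdj D₂ u w
UnionMinusAdj D₁ D₂ I (inj₁ _) (inj₂ _) = ⊥
UnionMinusAdj D₁ D₂ I (inj₂ _) (inj₁ _) = ⊥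

-- Keep the arcs of D₁ between surviving vertices and those of D₂, and pair each
-- deleted vertex i ∈ I with a source s of D₂ (possible since |I| ≤ |S|), redirecting
-- every arc x → i of D₁ to x → s. Competition through i becomes competition through s,
-- and since s has no in-neighbour in D₂ no vertex of D₂ competes with a vertex of D₁.
-- There are no arcs from D₂ back to D₁, so a cycle would lie inside D₁ or D₂.
module Submission where

open import Defs
open import Data.Nat using (ℕ; zero; suc; _<_; _≤_; s≤s; z≤n)
open import Data.Nat.Properties using (<-≤-trans; ≤-reflexive)
open import Data.Fin using (Fin; zero; suc)
open import Data.Fin.Subset using (Subset; _∈_; ∣_∣)
open import Data.Fin.Subset.Properties using (_∈?_; x∉p⇒x∈∁p)
open import Data.Bool using (true; false)
open import Data.Maybe using (Maybe; just; nothing; maybe)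
import Data.Maybe as Maybe
open import Data.Vec using (_∷_; []; here; there)
open import Data.Vec.Properties.WithK using ([]=-irrelevant)
open import Data.Product using (Σ; ∃; _×_; _,_; proj₁; proj₂)
open import Data.Product.Function.NonDependent.Propositional using (_×-⇔_)
open import Data.Sum using (_⊎_; inj₁; inj₂)
open import Data.Sum.Properties using (inj₁-injective; inj₂-injective)
open import Function using (_∘_; _on_)
open import Function.Bundles using (_⇔_; mk⇔)
import Function.Properties.Equivalence as ⇔
open import Relation.Nullary using (¬_; yes; no; contradiction)
open import Relation.Binary.PropositionalEquality
  using (_≡_; _≢_; refl; sym; trans; cong; module ≡-Reasoning)
open import Relation.Binary.Construct.Closure.Transitive using (TransClosure; [_]; _∷_)

private
  variable
    A B : Set
    n n₁ n₂ : ℕ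

rank : Subset n → Fin n → ℕ
rank (_     ∷ p) zero    = 0
rank (true  ∷ p) (suc i) = suc (rank p i)
rank (false ∷ p) (suc i) = rank p i

select : Subset n → ℕ → Maybe (Fin n)
select []          k       = nothing
select (true  ∷ p) zero    = just zero
select (true  ∷ p) (suc k) = Maybe.map suc (select p k)
select (false ∷ p) k       = Maybe.map suc (select p k)

select-∈ : ∀ (p : Subset n) k {i} → select p k ≡ just i → i ∈ p
select-∈ (true ∷ p) zero refl = here
select-∈ (true ∷ p) (suc k) e with select p k in eq | e
... | just j | refl = there (select-∈ p k eq)
select-∈ (false ∷ p) k e with select p k in eq | e
... | just j | refl = there (select-∈ p k eq)

select-rank : ∀ (p : Subset n) {i} → i ∈ p → select p (rank p i) ≡ just i
select-rank (true  ∷ p) here        = refl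
select-rank (true  ∷ p) (there i∈p) = cong (Maybe.map suc) (select-rank p i∈p)
select-rank (false ∷ p) (there i∈p) = cong (Maybe.map suc) (select-rank p i∈p)

rank<∣p∣ : ∀ (p : Subset n) {i} → i ∈ p → rank p i < ∣ p ∣
rank<∣p∣ (true  ∷ p) here        = s≤s z≤n
rank<∣p∣ (true  ∷ p) (there i∈p) = s≤s (rank<∣p∣ p i∈p)
rank<∣p∣ (false ∷ p) (there i∈p) = rank<∣p∣ p i∈p

rank-surjective : ∀ (p : Subset n) {k} → k < ∣ p ∣ → ∃ λ i → i ∈ p × rank p i ≡ k
rank-surjective (true ∷ p) {zero} _ = zero , here , refl
rank-surjective (true ∷ p) {suc k} (s≤s k<∣p∣) with rank-surjective p k<∣p∣
... | i , i∈p , refl = suc i , there i∈p , refl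
rank-surjective (false ∷ p) k<∣p∣ with rank-surjective p k<∣p∣
... | i , i∈p , refl = suc i , there i∈p , refl

matching : Subset n₂ → Subset n₁ → Fin n₂ → Maybe (Fin n₁)
matching S I s with s ∈? S
... | yes _ = select I (rank S s)
... | no  _ = nothing

matching-dom : ∀ (S : Subset n₂) (I : Subset n₁) {s i} → matching S I s ≡ just i → s ∈ S
matching-dom S I {s} e with s ∈? S
... | yes s∈S = s∈S

matching-∈ : ∀ (S : Subset n₂) (I : Subset n₁) {s} → s ∈ S → matching S I s ≡ select I (rank S s)
matching-∈ S I {s} s∈S with s ∈? S
... | yes _   = refl
... | no  s∉S = contradiction s∈S s∉S

matching-covers : ∀ (S : Subset n₂) (I : Subset n₁) → ∣ I ∣ ≤ ∣ S ∣ →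
                  ∀ {i} → i ∈ I → ∃ λ s → matching S I s ≡ just i
matching-covers S I ∣I∣≤∣S∣ {i} i∈I with rank-surjective S (<-≤-trans (rank<∣p∣ I i∈I) ∣I∣≤∣S∣)
... | s , s∈S , rank≡ = s , (begin
  matching S I s       ≡⟨ matching-∈ S I s∈S ⟩
  select I (rank S s)  ≡⟨ cong (select I) rank≡ ⟩
  select I (rank I i)  ≡⟨ select-rank I i∈I ⟩
  just i               ∎)
  where open ≡-Reasoning

Σ∈-≡ : ∀ {p : Subset n} {u w : Σ (Fin n) (_∈ p)} → proj₁ u ≡ proj₁ w → u ≡ w
Σ∈-≡ {u = i , i∈p} {w = .i , i∈p′} refl = cong (i ,_) ([]=-irrelevant i∈p i∈p′)

≢⇔≢-injective : ∀ {f : A → B} → (∀ {x y} → f x ≡ f y → x ≡ y) → ∀ {x y} → x ≢ y ⇔ f x ≢ f y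
≢⇔≢-injective f-injective = mk⇔ (λ x≢y → x≢y ∘ f-injective) (λ fx≢fy → fx≢fy ∘ cong _)

TransClosure-map : ∀ {D : Digraph A} (f : B → A) {x y} →
                   TransClosure (Arc (D on f)) x y → TransClosure (Arc D) (f x) (f y)
TransClosure-map f [ x→y ]      = [ x→y ]
TransClosure-map f (x→y ∷ y→⁺z) = x→y ∷ TransClosure-map f y→⁺z

Acyclic-on : ∀ {D : Digraph A} (f : B → A) → Acyclic D → Acyclic (D on f)
Acyclic-on f acyclic v cycle = acyclic (f v) (TransClosure-map f cycle)

module _ (D : Digraph (A ⊎ B)) (no-back-arc : ∀ b a → ¬ Arc D (inj₂ b) (inj₁ a)) where

  no-back-path : ∀ b a → ¬ TransClosure (Arc D) (inj₂ b) (inj₁ a)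
  no-back-path b a [ b→a ]                     = no-back-arc b a b→a
  no-back-path b a (_∷_ {y = inj₁ a′} b→a′ _)  = no-back-arc b a′ b→a′
  no-back-path b a (_∷_ {y = inj₂ b′} _ b′→⁺a) = no-back-path b′ a b′→⁺a

  path-inj₁ : ∀ {a a′} → TransClosure (Arc D) (inj₁ a) (inj₁ a′) →
              TransClosure (Arc (D on inj₁)) a a′
  path-inj₁ [ a→a′ ]                             = [ a→a′ ]
  path-inj₁ (_∷_ {y = inj₁ _} a→a″ a″→⁺a′)       = a→a″ ∷ path-inj₁ a″→⁺a′
  path-inj₁ {a′ = a′} (_∷_ {y = inj₂ b} _ b→⁺a′) = contradiction b→⁺a′ (no-back-path b a′)

  path-inj₂ : ∀ {b b′} → TransClosure (Arc D) (inj₂ b) (inj₂ b′) →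
              TransClosure (Arc (D on inj₂)) b b′
  path-inj₂ [ b→b′ ]                       = [ b→b′ ]
  path-inj₂ {b} (_∷_ {y = inj₁ a} b→a _)   = contradiction b→a (no-back-arc b a)
  path-inj₂ (_∷_ {y = inj₂ _} b→b″ b″→⁺b′) = b→b″ ∷ path-inj₂ b″→⁺b′

  Acyclic-⊎ : Acyclic (D on inj₁) → Acyclic (D on inj₂) → Acyclic D
  Acyclic-⊎ acyclic₁ acyclic₂ (inj₁ a) cycle = acyclic₁ a (path-inj₁ cycle)
  Acyclic-⊎ acyclic₁ acyclic₂ (inj₂ b) cycle = acyclic₂ b (path-inj₂ cycle)

CommonOut : Digraph A → A → A → Set
CommonOut {A} D x y = ∃ λ (v : A) → Arc D x v × Arc D y v

module Merge (D₁ : Digraph (Fin n₁)) (D₂ : Digraph (Fin n₂)) (I : Subset n₁)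
             (τ : Fin n₂ → Maybe (Fin n₁)) where

  merge : Digraph (RemVert I n₂)
  merge (inj₁ (x , _)) (inj₁ (v , _)) = D₁ x v
  merge (inj₁ (x , _)) (inj₂ s)       = maybe (D₁ x) false (τ s)
  merge (inj₂ _)       (inj₁ _)       = false
  merge (inj₂ a)       (inj₂ b)       = D₂ a b

  redirected-arc : ∀ x s → Arc merge (inj₁ x) (inj₂ s) →
                   ∃ λ i → τ s ≡ just i × Arc D₁ (proj₁ x) i
  redirected-arc x s x→s with τ s
  ... | just i = i , refl , x→s

  redirect-arc : ∀ x {s i} → τ s ≡ just i → Arc D₁ (proj₁ x) i → Arc merge (inj₁ x) (inj₂ s)
  redirect-arc x τs≡i x→i rewrite τs≡i = x→i

  merge-acyclic : Acyclic D₁ → Acyclic D₂ → Acyclic merge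
  merge-acyclic acyclic₁ acyclic₂ =
    Acyclic-⊎ merge (λ _ _ ()) (Acyclic-on proj₁ acyclic₁) acyclic₂

  module _ (τ-source : ∀ {s i} → τ s ≡ just i → NoInNeighbor D₂ s)
           (τ-covers : ∀ {i} → i ∈ I → ∃ λ s → τ s ≡ just i) where

    common-inj₁ : ∀ {x y} → CommonOut merge (inj₁ x) (inj₁ y) ⇔ CommonOut D₁ (proj₁ x) (proj₁ y)
    common-inj₁ = mk⇔ to from
      where
      to : ∀ {x y} → CommonOut merge (inj₁ x) (inj₁ y) → CommonOut D₁ (proj₁ x) (proj₁ y)
      to (inj₁ (v , _) , x→v , y→v) = v , x→v , y→v
      to {x} {y} (inj₂ s , x→s , y→s) with redirected-arc x s x→s | redirected-arc y s y→s
      ... | i , τs≡i , x→i | j , τs≡j , y→j with trans (sym τs≡i) τs≡j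
      ...   | refl = i , x→i , y→j

      from : ∀ {x y} → CommonOut D₁ (proj₁ x) (proj₁ y) → CommonOut merge (inj₁ x) (inj₁ y)
      from {x} {y} (v , x→v , y→v) with v ∈? I
      ... | no  v∉I = inj₁ (v , x∉p⇒x∈∁p v∉I) , x→v , y→v
      ... | yes v∈I with τ-covers v∈I
      ...   | s , τs≡v = inj₂ s , redirect-arc x τs≡v x→v , redirect-arc y τs≡v y→v

    common-inj₂ : ∀ {a b} → CommonOut merge (inj₂ a) (inj₂ b) ⇔ CommonOut D₂ a b
    common-inj₂ = mk⇔ (λ { (inj₂ v , a→v , b→v) → v , a→v , b→v })
                      (λ { (v , a→v , b→v) → inj₂ v , a→v , b→v })

    no-common-inj₁-inj₂ : ∀ {x b} → ¬ CommonOut merge (inj₁ x) (inj₂ b)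
    no-common-inj₁-inj₂ {x} (inj₂ s , x→s , b→s) with redirected-arc x s x→s
    ... | _ , τs≡i , _ = τ-source τs≡i _ b→s

    merge-competition : ∀ x y → CompAdj merge x y ⇔ UnionMinusAdj D₁ D₂ I x y
    merge-competition (inj₁ u) (inj₁ w) =
      ⇔.trans (⇔.sym (≢⇔≢-injective inj₁-injective)) (≢⇔≢-injective Σ∈-≡) ×-⇔ common-inj₁
    merge-competition (inj₁ u) (inj₂ b) = mk⇔ (no-common-inj₁-inj₂ ∘ proj₂) λ ()
    merge-competition (inj₂ a) (inj₁ w) =
      mk⇔ (λ { (_ , v , a→v , w→v) → no-common-inj₁-inj₂ (v , w→v , a→v) }) λ ()
    merge-competition (inj₂ a) (inj₂ b) =
      ⇔.sym (≢⇔≢-injective inj₂-injective) ×-⇔ common-inj₂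

lemma2p5 : ∀ {n₁ n₂ : ℕ} (D₁ : Digraph (Fin n₁)) (D₂ : Digraph (Fin n₂)) (p : ℕ) →
    Acyclic D₁ → Acyclic D₂ →
    (S : Subset n₂) → ∣ S ∣ ≡ p → (∀ v → v ∈ S → NoInNeighbor D₂ v) →
    (I : Subset n₁) → ∣ I ∣ ≡ p → (∀ u → u ∈ I → IsolatedInC D₁ u) →
    Σ (Digraph (RemVert I n₂)) (λ D →
      Acyclic D × (∀ x y → CompAdj D x y ⇔ UnionMinusAdj D₁ D₂ I x y))
lemma2p5 D₁ D₂ p acyclic₁ acyclic₂ S ∣S∣≡p S-sources I ∣I∣≡p _ =
  merge , merge-acyclic acyclic₁ acyclic₂ ,
  merge-competition (λ {s} τs≡i → S-sources s (matching-dom S I τs≡i))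
                    (matching-covers S I (≤-reflexive (trans ∣I∣≡p (sym ∣S∣≡p))))
  where open Merge D₁ D₂ I (matching S I)
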